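{- For every formula $\phi$, every maximally-consistent base $\mathscr{B}$, and every family $\mathfrak{R}_A=(\mathfrak{R}_a)_{a\in A}$ of $S5$-modal relations, either $\Vdash_{\mathscr{B},\mathfrak{R}_A}\phi$ or $\Vdash_{\mathscr{B},\mathfrak{R}_A}\phi\to\bot$.
   Context: Fix a countably infinite set of atomic formulae and a nonempty set $A$ of agents. Formulae: $\phi ::= p \mid \bot \mid \phi\to\phi \mid K_a\phi$ with $p$ atomic and $a\in A$. A base rule is written $p_1,\dots,p_n\Rightarrow p$, where $\{p_1,\dots,p_n\}$ is a finite (possibly empty) set of atoms and $p$ is an atom. A base is a countable set of base rules; $\Omega$ is the set of all bases. $\overline{\mathscr{B}}$ is the smallest set of atoms closed under the rules of $\mathscr{B}$. A base $\mathscr{B}$ is inconsistent iff every atom lies in $\overline{\mathscr{B}}$, and consistent otherwise. A base $\mathscr{B}$ is maximally-consistent iff it is consistent and for every base rule $\delta$, either $\delta\in\mathscr{B}$ or $\mathscr{B}\cup\{\delta\}$ is inconsistent. An $S5$-modal relation is a binary relation $\mathfrak{R}$ on $\Omega$ that is reflexive, transitive and Euclidean (if $\mathfrak{R}\mathscr{B}\mathscr{C}$ and $\mathfrak{R}\mathscr{B}\mathscr{D}$ then $\mathfrak{R}\mathscr{C}\mathscr{D}$) and satisfies, for all bases $\mathscr{B}$: (a) if $\mathscr{B}$ is inconsistent, there is an inconsistent $\mathscr{C}$ with $\mathfrak{R}\mathscr{B}\mathscr{C}$, and every $\mathscr{D}$ with $\mathfrak{R}\mathscr{B}\mathscr{D}$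 is inconsistent; (b) if $\mathscr{B}$ is consistent, every $\mathscr{C}$ with $\mathfrak{R}\mathscr{B}\mathscr{C}$ is consistent; (c) for all $\mathscr{C}$, if $\mathfrak{R}\mathscr{B}\mathscr{C}$ then for every consistent $\mathscr{D}\supseteq\mathscr{B}$ there is $\mathscr{E}\supseteq\mathscr{C}$ with $\mathfrak{R}\mathscr{D}\mathscr{E}$; (d) for all consistent $\mathscr{C}$, if $\mathfrak{R}\mathscr{B}\mathscr{C}$ then for every $\mathscr{D}\subseteq\mathscr{B}$ there is $\mathscr{E}\subseteq\mathscr{C}$ with $\mathfrak{R}\mathscr{D}\mathscr{E}$. For a family $\mathfrak{R}_A=(\mathfrak{R}_a)_{a\in A}$ of $S5$-modal relations, validity at a base is defined inductively: $\Vdash_{\mathscr{B},\mathfrak{R}_A}p$ iff $p\in\overline{\mathscr{B}}$; $\Vdash_{\mathscr{B},\mathfrak{R}_A}\phi\to\psi$ iff $\phi\Vdash_{\mathscr{B},\mathfrak{R}_A}\psi$; $\Vdash_{\mathscr{B},\mathfrak{R}_A}\bot$ iff $\Vdash_{\mathscr{B},\mathfrak{R}_A}p$ for every atom $p$; $\Vdash_{\mathscr{B},\mathfrak{R}_A}K_a\phi$ iff $\Vdash_{\mathscr{C},\mathfrak{R}_A}\phi$ for all $\mathscr{C}$ with $\mathfrak{R}_a\mathscr{B}\mathscr{C}$; and for a nonempty set $\Gamma$ of formulae, $\Gamma\Vdash_{\mathscr{B},\mathfrak{R}_A}\phi$ iff for every $\mathscr{C}\supseteq\mathscr{B}$, if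 $\Vdash_{\mathscr{C},\mathfrak{R}_A}\psi$ for all $\psi\in\Gamma$ then $\Vdash_{\mathscr{C},\mathfrak{R}_A}\phi$. -}

module Defs where

open import Level using (Level; Lift; lift) renaming (suc to lsuc; zero to lzero)
open import Data.Nat using (ℕ)
open import Data.List using (List)
open import Data.List.Relation.Unary.All using (All)
open import Data.Product using (Σ; _×_; ∃)
open import Data.Sum using (_⊎_)
open import Relation.Nullary using (¬_)
open import Relation.Binary.PropositionalEquality using (_≡_)

Atom : Set
Atom = ℕ

data Formula (A : Set) : Set where
  atom : Atom → Formula A
  ⊥f   : Formula A
  _⟶_  : Formula A → Formula A → Formula A
  K    : A → Formula A → Formula A

record Rule : Set where
  constructor _⇒_
  field
    premises   : List Atom
    conclusion : Atom

-- A base is a set of base rules (every such set is countable, as Rule is).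
Base : Set₁
Base = Rule → Set

_⊆B_ : Base → Base → Set
B ⊆B C = ∀ r → B r → C r

_∪｛_｝ : Base → Rule → Base
(B ∪｛ δ ｝) r = B r ⊎ (r ≡ δ)

data Closure (B : Base) : Atom → Set where
  by : ∀ {ps p} → B (ps ⇒ p) → All (Closure B) ps → Closure B p

Inconsistent : Base → Set
Inconsistent B = ∀ p → Closure B p

Consistent : Base → Set
Consistent B = ¬ Inconsistent B

MaximallyConsistent : Base → Set
MaximallyConsistent B = Consistent B × (∀ δ → B δ ⊎ Inconsistent (B ∪｛ δ ｝))

Rel : Set₁
Rel = Base → Base → Set

record IsS5 (R : Rel) : Set₁ where
  field
    refl      : ∀ B → R B B
    trans     : ∀ {B C D} → R B C → R C D → R B D
    euclidean : ∀ {B C D} → R B C → R B D → R C D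
    condA     : ∀ B → Inconsistent B →
                  (Σ Base λ C → R B C × Inconsistent C)
                  × (∀ D → R B D → Inconsistent D)
    condB     : ∀ B → Consistent B → ∀ C → R B C → Consistent C
    condC     : ∀ B C → R B C →
                  ∀ D → Consistent D → B ⊆B D →
                  Σ Base λ E → C ⊆B E × R D E
    condD     : ∀ B C → Consistent C → R B C →
                  ∀ D → D ⊆B B →
                  Σ Base λ E → E ⊆B C × R D E

⊩ : {A : Set} → (A → Rel) → Base → Formula A → Set₁
⊩ R B (atom p) = Lift (lsuc lzero) (Closure B p)
⊩ R B ⊥f       = ∀ p → ⊩ R B (atom p)
⊩ R B (φ ⟶ ψ)  = ∀ C → B ⊆B C → ⊩ R C φ → ⊩ R C ψ
⊩ R B (K a φ)  = ∀ C → R a B C → ⊩ R C φ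

{-# OPTIONS --safe #-}
-- Validity is persistent along base extension. For K_a this is condition (d), which only
-- applies to consistent targets; inconsistent targets are harmless because, by condition (a),
-- every formula is valid at an inconsistent base. A maximally-consistent base B has no
-- consistent proper extension, so if φ is not valid at B, any extension of B at which φ is
-- valid must be inconsistent, and hence validates ⊥: that is, φ ⟶ ⊥ is valid at B.
module Submission where

open import Defs
open import Level using (Lift; lift; lower) renaming (suc to lsuc; zero to lzero)
open import Data.Sum using (_⊎_; inj₁; inj₂)
open import Data.Product using (_,_; proj₂)
open import Data.List.Relation.Unary.All using (All; []; _∷_)
open import Relation.Nullary using (Dec; yes; no; contradiction)
open import Relation.Nullary.Decidable using (map′)
open import Relation.Binary.PropositionalEquality using (refl)
open import Axiom.ExcludedMiddle using (ExcludedMiddle)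

mutual
  Closure-mono : ∀ {B C} → B ⊆B C → ∀ {p} → Closure B p → Closure C p
  Closure-mono B⊆C (by r cs) = by (B⊆C _ r) (All-Closure-mono B⊆C cs)

  All-Closure-mono : ∀ {B C} → B ⊆B C → ∀ {ps} → All (Closure B) ps → All (Closure C) ps
  All-Closure-mono B⊆C []       = []
  All-Closure-mono B⊆C (c ∷ cs) = Closure-mono B⊆C c ∷ All-Closure-mono B⊆C cs

Inconsistent-mono : ∀ {B C} → B ⊆B C → Inconsistent B → Inconsistent C
Inconsistent-mono B⊆C inc p = Closure-mono B⊆C (inc p)

∪｛｝-least : ∀ {B C δ} → B ⊆B C → C δ → (B ∪｛ δ ｝) ⊆B C
∪｛｝-least B⊆C Cδ r (inj₁ Br)   = B⊆C r Br
∪｛｝-least B⊆C Cδ r (inj₂ refl) = Cδ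

maximal-consistent-extension : ∀ {B C} → MaximallyConsistent B →
                               B ⊆B C → Consistent C → C ⊆B B
maximal-consistent-extension (_ , maximal) B⊆C consC δ Cδ with maximal δ
... | inj₁ Bδ  = Bδ
... | inj₂ inc = contradiction (Inconsistent-mono (∪｛｝-least B⊆C Cδ) inc) consC

Inconsistent? : ExcludedMiddle (lsuc lzero) → ∀ B → Dec (Inconsistent B)
Inconsistent? em B = map′ lower lift (em {Lift (lsuc lzero) (Inconsistent B)})

module _ (em : ExcludedMiddle (lsuc lzero)) {A : Set}
         (R : A → Rel) (isS5 : ∀ a → IsS5 (R a)) where

  ⊩-inconsistent : ∀ φ {B} → Inconsistent B → ⊩ R B φ
  ⊩-inconsistent (atom p) inc = lift (inc p)
  ⊩-inconsistent ⊥f       inc = λ p → lift (inc p)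
  ⊩-inconsistent (φ ⟶ ψ)  inc = λ C B⊆C _ → ⊩-inconsistent ψ (Inconsistent-mono B⊆C inc)
  ⊩-inconsistent (K a φ) {B} inc =
    λ C RBC → ⊩-inconsistent φ (proj₂ (IsS5.condA (isS5 a) B inc) C RBC)

  ⊩-mono : ∀ φ {B C} → B ⊆B C → ⊩ R B φ → ⊩ R C φ
  ⊩-mono (atom p) B⊆C (lift c) = lift (Closure-mono B⊆C c)
  ⊩-mono ⊥f       B⊆C ⊩⊥      = λ p → ⊩-mono (atom p) B⊆C (⊩⊥ p)
  ⊩-mono (φ ⟶ ψ)  B⊆C ⊩φ⟶ψ   = λ D C⊆D → ⊩φ⟶ψ D (λ r Br → C⊆D r (B⊆C r Br))
  ⊩-mono (K a φ) {B} {C} B⊆C ⊩Kφ D RCD with Inconsistent? em D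
  ... | yes inc = ⊩-inconsistent φ inc
  ... | no cons with IsS5.condD (isS5 a) C D cons RCD B B⊆C
  ...   | E , E⊆D , RBE = ⊩-mono φ E⊆D (⊩Kφ E RBE)

lemma4p7 : ExcludedMiddle (lsuc lzero) →
    (A : Set) → A →
    (R : A → Rel) → (∀ a → IsS5 (R a)) →
    (φ : Formula A) (B : Base) → MaximallyConsistent B →
    ⊩ R B φ ⊎ ⊩ R B (φ ⟶ ⊥f)
lemma4p7 em A _ R isS5 φ B maxB with em {⊩ R B φ}
... | yes ⊩φ = inj₁ ⊩φ
... | no ⊮φ  = inj₂ λ C B⊆C ⊩Cφ → ⊩-inconsistent em R isS5 ⊥f (inconsistent B⊆C ⊩Cφ)
  where
  inconsistent : ∀ {C} → B ⊆B C → ⊩ R C φ → Inconsistent C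
  inconsistent {C} B⊆C ⊩Cφ with Inconsistent? em C
  ... | yes inc  = inc
  ... | no consC =
    contradiction (⊩-mono em R isS5 φ (maximal-consistent-extension maxB B⊆C consC) ⊩Cφ) ⊮φ
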